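{- Let $n$ be a positive integer. Any triangle-free subset of the $2$-distance graph of the $n$-dimensional hypercube contains at most $\frac{4\cdot 2^n}{n}$ vertices.
   Context: The $n$-dimensional hypercube has vertex set $\{0,1\}^n$. The Hamming distance of two $0$--$1$ sequences of the same length is the number of positions in which they differ. The $2$-distance graph of the $n$-dimensional hypercube is the graph on $\{0,1\}^n$ in which two vertices are adjacent if and only if their Hamming distance is exactly $2$. A subset of the vertices is triangle-free if it contains no three vertices that are pairwise at Hamming distance exactly $2$. -}

module Defs where

open import Data.Nat using (ℕ; zero; suc)
open import Data.Bool using (Bool; true; false)
open import Data.Vec using (Vec; []; _∷_)
open import Data.List using (List)
open import Data.List.Membership.Propositional using (_∈_)
open import Relation.Binary.PropositionalEquality using (_≡_)
open import Relation.Nullary using (¬_)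
open import Data.Product using (_×_)

Vertex : ℕ → Set
Vertex n = Vec Bool n

hamming : ∀ {n} → Vertex n → Vertex n → ℕ
hamming []      []      = 0
hamming (x ∷ xs) (y ∷ ys) with x Data.Bool.xor y
... | true  = suc (hamming xs ys)
... | false = hamming xs ys

Adj₂ : ∀ {n} → Vertex n → Vertex n → Set
Adj₂ u v = hamming u v ≡ 2

TriangleFree : ∀ {n} → List (Vertex n) → Set
TriangleFree {n} S =
  ∀ (u v w : Vertex n) → u ∈ S → v ∈ S → w ∈ S →
  ¬ (Adj₂ u v × Adj₂ v w × Adj₂ u w)

-- Double count the pairs (x , y) with x ∈ S and y a hypercube vertex at Hamming
-- distance 1 from x. Every x has exactly n such neighbours y. Conversely, two
-- distinct vertices at distance 1 from the same y are at distance 2 from each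
-- other, so three members of S adjacent to a common y would form a triangle;
-- hence every y is counted at most twice, and |S| · n ≤ 2 · 2ⁿ.
module Submission where

open import Defs
open import Data.Bool using (true; false)
open import Data.Empty using (⊥-elim)
open import Data.List using (List; []; _∷_; _++_; map; length; filter)
open import Data.List.Membership.Propositional using (_∈_)
open import Data.List.Membership.Propositional.Properties using (∈-filter⁻)
open import Data.List.Properties using (length-++; length-map)
open import Data.List.Relation.Unary.AllPairs using (_∷_)
open import Data.List.Relation.Unary.All using (_∷_)
open import Data.List.Relation.Unary.Any using (here; there)
open import Data.List.Relation.Unary.Unique.Propositional using (Unique)
open import Data.List.Relation.Unary.Unique.Propositional.Properties using (filter⁺)
open import Data.Nat using (ℕ; zero; suc; _+_; _*_; _^_; _≤_; _≟_; z≤n; s≤s)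
open import Data.Nat.Properties
open import Algebra.Properties.CommutativeSemigroup +-commutativeSemigroup using (interchange)
open import Data.Product using (_×_; _,_)
open import Data.Vec using ([]; _∷_)
open import Function using (_∘_)
open import Relation.Binary.PropositionalEquality

private variable A B : Set

∑ : List A → (A → ℕ) → ℕ
∑ []       f = 0
∑ (x ∷ xs) f = f x + ∑ xs f

syntax ∑ xs (λ x → e) = ∑[ x ∈ xs ] e

∑-const : (xs : List A) (c : ℕ) → ∑[ _ ∈ xs ] c ≡ length xs * c
∑-const []       c = refl
∑-const (x ∷ xs) c = cong (c +_) (∑-const xs c)

∑-zero : (xs : List A) → ∑[ _ ∈ xs ] 0 ≡ 0
∑-zero xs = trans (∑-const xs 0) (*-zeroʳ (length xs))

∑-mono : (xs : List A) {f g : A → ℕ} → (∀ x → f x ≤ g x) → ∑ xs f ≤ ∑ xs g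
∑-mono []       f≤g = z≤n
∑-mono (x ∷ xs) f≤g = +-mono-≤ (f≤g x) (∑-mono xs f≤g)

∑-+ : (xs : List A) (f g : A → ℕ) → ∑[ x ∈ xs ] (f x + g x) ≡ ∑ xs f + ∑ xs g
∑-+ []       f g = refl
∑-+ (x ∷ xs) f g = begin
  f x + g x + ∑[ x ∈ xs ] (f x + g x)  ≡⟨ cong (f x + g x +_) (∑-+ xs f g) ⟩
  f x + g x + (∑ xs f + ∑ xs g)        ≡⟨ interchange (f x) (g x) (∑ xs f) (∑ xs g) ⟩
  f x + ∑ xs f + (g x + ∑ xs g)        ∎
  where open ≡-Reasoning

∑-++ : (xs ys : List A) (f : A → ℕ) → ∑ (xs ++ ys) f ≡ ∑ xs f + ∑ ys f
∑-++ []       ys f = refl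
∑-++ (x ∷ xs) ys f = trans (cong (f x +_) (∑-++ xs ys f)) (sym (+-assoc (f x) _ _))

∑-map : (g : B → A) (ys : List B) (f : A → ℕ) → ∑ (map g ys) f ≡ ∑[ y ∈ ys ] f (g y)
∑-map g []       f = refl
∑-map g (y ∷ ys) f = cong (f (g y) +_) (∑-map g ys f)

∑-comm : (xs : List A) (ys : List B) (f : A → B → ℕ) →
  ∑[ x ∈ xs ] ∑[ y ∈ ys ] f x y ≡ ∑[ y ∈ ys ] ∑[ x ∈ xs ] f x y
∑-comm []       ys f = sym (∑-zero ys)
∑-comm (x ∷ xs) ys f = begin
  ∑ ys (f x) + ∑[ x ∈ xs ] ∑[ y ∈ ys ] f x y  ≡⟨ cong (∑ ys (f x) +_) (∑-comm xs ys f) ⟩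
  ∑ ys (f x) + ∑[ y ∈ ys ] ∑[ x ∈ xs ] f x y  ≡⟨ ∑-+ ys (f x) (λ y → ∑[ x ∈ xs ] f x y) ⟨
  ∑[ y ∈ ys ] (f x y + ∑[ x ∈ xs ] f x y)     ∎
  where open ≡-Reasoning

double-counting : (xs : List A) (ys : List B) (r : A → B → ℕ) {d k : ℕ} →
  (∀ x → d ≤ ∑[ y ∈ ys ] r x y) → (∀ y → ∑[ x ∈ xs ] r x y ≤ k) →
  length xs * d ≤ length ys * k
double-counting xs ys r {d} {k} degree≥d codegree≤k = begin
  length xs * d                    ≡⟨ ∑-const xs d ⟨
  ∑[ _ ∈ xs ] d                    ≤⟨ ∑-mono xs degree≥d ⟩
  ∑[ x ∈ xs ] ∑[ y ∈ ys ] r x y    ≡⟨ ∑-comm xs ys r ⟩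
  ∑[ y ∈ ys ] ∑[ x ∈ xs ] r x y    ≤⟨ ∑-mono ys codegree≤k ⟩
  ∑[ _ ∈ ys ] k                    ≡⟨ ∑-const ys k ⟩
  length ys * k                    ∎
  where open ≤-Reasoning

isZero : ℕ → ℕ
isZero zero    = 1
isZero (suc _) = 0

isOne : ℕ → ℕ
isOne zero    = 0
isOne (suc d) = isZero d

∑-isOne≡length-filter : (f : A → ℕ) (xs : List A) →
  ∑[ x ∈ xs ] isOne (f x) ≡ length (filter (λ x → f x ≟ 1) xs)
∑-isOne≡length-filter f []       = refl
∑-isOne≡length-filter f (x ∷ xs) with f x
... | zero        = ∑-isOne≡length-filter f xs
... | suc zero    = cong suc (∑-isOne≡length-filter f xs)
... | suc (suc _) = ∑-isOne≡length-filter f xs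

hamming-sym : ∀ {n} (x y : Vertex n) → hamming x y ≡ hamming y x
hamming-sym []           []           = refl
hamming-sym (true ∷ xs)  (true ∷ ys)  = hamming-sym xs ys
hamming-sym (false ∷ xs) (false ∷ ys) = hamming-sym xs ys
hamming-sym (true ∷ xs)  (false ∷ ys) = cong suc (hamming-sym xs ys)
hamming-sym (false ∷ xs) (true ∷ ys)  = cong suc (hamming-sym xs ys)

hamming≡0⇒≡ : ∀ {n} (x y : Vertex n) → hamming x y ≡ 0 → x ≡ y
hamming≡0⇒≡ []           []           _  = refl
hamming≡0⇒≡ (true ∷ xs)  (true ∷ ys)  eq = cong (true ∷_) (hamming≡0⇒≡ xs ys eq)
hamming≡0⇒≡ (false ∷ xs) (false ∷ ys) eq = cong (false ∷_) (hamming≡0⇒≡ xs ys eq)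

hamming≡1∧hamming≡1⇒hamming≡2 : ∀ {n} (x y z : Vertex n) →
  hamming x y ≡ 1 → hamming z y ≡ 1 → x ≢ z → hamming x z ≡ 2
hamming≡1∧hamming≡1⇒hamming≡2 [] [] [] () _ _
hamming≡1∧hamming≡1⇒hamming≡2 (true ∷ xs) (true ∷ ys) (true ∷ zs) xy zy x≢z =
  hamming≡1∧hamming≡1⇒hamming≡2 xs ys zs xy zy (x≢z ∘ cong (true ∷_))
hamming≡1∧hamming≡1⇒hamming≡2 (false ∷ xs) (false ∷ ys) (false ∷ zs) xy zy x≢z =
  hamming≡1∧hamming≡1⇒hamming≡2 xs ys zs xy zy (x≢z ∘ cong (false ∷_))
hamming≡1∧hamming≡1⇒hamming≡2 (true ∷ xs) (false ∷ ys) (true ∷ zs) xy zy x≢z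
  with refl ← hamming≡0⇒≡ xs ys (suc-injective xy) | refl ← hamming≡0⇒≡ zs ys (suc-injective zy)
  = ⊥-elim (x≢z refl)
hamming≡1∧hamming≡1⇒hamming≡2 (false ∷ xs) (true ∷ ys) (false ∷ zs) xy zy x≢z
  with refl ← hamming≡0⇒≡ xs ys (suc-injective xy) | refl ← hamming≡0⇒≡ zs ys (suc-injective zy)
  = ⊥-elim (x≢z refl)
hamming≡1∧hamming≡1⇒hamming≡2 (true ∷ xs) (false ∷ ys) (false ∷ zs) xy zy _
  with refl ← hamming≡0⇒≡ xs ys (suc-injective xy) = cong suc (trans (hamming-sym ys zs) zy)
hamming≡1∧hamming≡1⇒hamming≡2 (false ∷ xs) (true ∷ ys) (true ∷ zs) xy zy _
  with refl ← hamming≡0⇒≡ xs ys (suc-injective xy) = cong suc (trans (hamming-sym ys zs) zy)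
hamming≡1∧hamming≡1⇒hamming≡2 (true ∷ xs) (true ∷ ys) (false ∷ zs) xy zy _
  with refl ← hamming≡0⇒≡ zs ys (suc-injective zy) = cong suc xy
hamming≡1∧hamming≡1⇒hamming≡2 (false ∷ xs) (false ∷ ys) (true ∷ zs) xy zy _
  with refl ← hamming≡0⇒≡ zs ys (suc-injective zy) = cong suc xy

vertices : (n : ℕ) → List (Vertex n)
vertices zero    = [] ∷ []
vertices (suc n) = map (true ∷_) (vertices n) ++ map (false ∷_) (vertices n)

length-vertices : ∀ n → length (vertices n) ≡ 2 ^ n
length-vertices zero    = refl
length-vertices (suc n) = begin
  length (map (true ∷_) (vertices n) ++ map (false ∷_) (vertices n))  ≡⟨ length-++ (map (true ∷_) (vertices n)) ⟩
  length (map (true ∷_) (vertices n)) + length (map (false ∷_) (vertices n))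
    ≡⟨ cong₂ _+_ (length-map (true ∷_) (vertices n)) (length-map (false ∷_) (vertices n)) ⟩
  length (vertices n) + length (vertices n)  ≡⟨ cong₂ _+_ (length-vertices n) (length-vertices n) ⟩
  2 ^ n + 2 ^ n                              ≡⟨ cong (2 ^ n +_) (+-identityʳ (2 ^ n)) ⟨
  2 ^ suc n                                  ∎
  where open ≡-Reasoning

∑-vertices-suc : ∀ {n} (f : Vertex (suc n) → ℕ) →
  ∑ (vertices (suc n)) f ≡ ∑[ y ∈ vertices n ] f (true ∷ y) + ∑[ y ∈ vertices n ] f (false ∷ y)
∑-vertices-suc {n} f = trans (∑-++ (map (true ∷_) (vertices n)) _ f)
  (cong₂ _+_ (∑-map (true ∷_) (vertices n) f) (∑-map (false ∷_) (vertices n) f))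

count-distance-0 : ∀ {n} (x : Vertex n) → ∑[ y ∈ vertices n ] isZero (hamming x y) ≡ 1
count-distance-0 []                   = refl
count-distance-0 {suc n} (true ∷ xs)  = begin
  ∑[ y ∈ vertices (suc n) ] isZero (hamming (true ∷ xs) y)  ≡⟨ ∑-vertices-suc {n} _ ⟩
  ∑[ y ∈ vertices n ] isZero (hamming xs y) + ∑[ _ ∈ vertices n ] 0
    ≡⟨ cong₂ _+_ (count-distance-0 xs) (∑-zero (vertices n)) ⟩
  1                                                          ∎
  where open ≡-Reasoning
count-distance-0 {suc n} (false ∷ xs) = begin
  ∑[ y ∈ vertices (suc n) ] isZero (hamming (false ∷ xs) y)  ≡⟨ ∑-vertices-suc {n} _ ⟩
  ∑[ _ ∈ vertices n ] 0 + ∑[ y ∈ vertices n ] isZero (hamming xs y)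
    ≡⟨ cong₂ _+_ (∑-zero (vertices n)) (count-distance-0 xs) ⟩
  1                                                           ∎
  where open ≡-Reasoning

count-distance-1 : ∀ {n} (x : Vertex n) → ∑[ y ∈ vertices n ] isOne (hamming x y) ≡ n
count-distance-1 []                   = refl
count-distance-1 {suc n} (true ∷ xs)  = begin
  ∑[ y ∈ vertices (suc n) ] isOne (hamming (true ∷ xs) y)  ≡⟨ ∑-vertices-suc {n} _ ⟩
  ∑[ y ∈ vertices n ] isOne (hamming xs y) + ∑[ y ∈ vertices n ] isZero (hamming xs y)
    ≡⟨ cong₂ _+_ (count-distance-1 xs) (count-distance-0 xs) ⟩
  n + 1                                                     ≡⟨ +-comm n 1 ⟩
  suc n                                                     ∎
  where open ≡-Reasoning
count-distance-1 {suc n} (false ∷ xs) = begin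
  ∑[ y ∈ vertices (suc n) ] isOne (hamming (false ∷ xs) y)  ≡⟨ ∑-vertices-suc {n} _ ⟩
  ∑[ y ∈ vertices n ] isZero (hamming xs y) + ∑[ y ∈ vertices n ] isOne (hamming xs y)
    ≡⟨ cong₂ _+_ (count-distance-0 xs) (count-distance-1 xs) ⟩
  suc n                                                      ∎
  where open ≡-Reasoning

module _ {n} {S : List (Vertex n)} (triangleFree : TriangleFree S) (y : Vertex n) where

  triangleFree⇒neighbours≤2 : (T : List (Vertex n)) → Unique T →
    (∀ {x} → x ∈ T → x ∈ S × hamming x y ≡ 1) → length T ≤ 2
  triangleFree⇒neighbours≤2 []              _ _ = z≤n
  triangleFree⇒neighbours≤2 (_ ∷ [])        _ _ = s≤s z≤n
  triangleFree⇒neighbours≤2 (_ ∷ _ ∷ [])    _ _ = s≤s (s≤s z≤n)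
  triangleFree⇒neighbours≤2 (a ∷ b ∷ c ∷ _) ((a≢b ∷ a≢c ∷ _) ∷ (b≢c ∷ _) ∷ _) T⊆N
    with T⊆N (here refl) | T⊆N (there (here refl)) | T⊆N (there (there (here refl)))
  ... | a∈S , ay | b∈S , by | c∈S , cy = ⊥-elim (triangleFree a b c a∈S b∈S c∈S
        ( hamming≡1∧hamming≡1⇒hamming≡2 a y b ay by a≢b
        , hamming≡1∧hamming≡1⇒hamming≡2 b y c by cy b≢c
        , hamming≡1∧hamming≡1⇒hamming≡2 a y c ay cy a≢c))

  triangleFree⇒codegree≤2 : Unique S → ∑[ x ∈ S ] isOne (hamming x y) ≤ 2
  triangleFree⇒codegree≤2 unique = begin
    ∑[ x ∈ S ] isOne (hamming x y)              ≡⟨ ∑-isOne≡length-filter (λ x → hamming x y) S ⟩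
    length (filter (λ x → hamming x y ≟ 1) S)  ≤⟨ triangleFree⇒neighbours≤2 _
                                                    (filter⁺ (λ x → hamming x y ≟ 1) unique)
                                                    (∈-filter⁻ (λ x → hamming x y ≟ 1)) ⟩
    2                                           ∎
    where open ≤-Reasoning

mainTheorem3 : (n : ℕ) → 1 ≤ n → (S : List (Vertex n)) → Unique S → TriangleFree S →
    length S * n ≤ 4 * 2 ^ n
mainTheorem3 n _ S unique triangleFree = begin
  length S * n               ≤⟨ double-counting S (vertices n) (λ x y → isOne (hamming x y))
                                  (λ x → ≤-reflexive (sym (count-distance-1 x)))
                                  (λ y → triangleFree⇒codegree≤2 triangleFree y unique) ⟩
  length (vertices n) * 2    ≡⟨ cong (_* 2) (length-vertices n) ⟩
  2 ^ n * 2                  ≡⟨ *-comm (2 ^ n) 2 ⟩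
  2 * 2 ^ n                  ≤⟨ *-monoˡ-≤ (2 ^ n) {2} {4} (s≤s (s≤s z≤n)) ⟩
  4 * 2 ^ n                  ∎
  where open ≤-Reasoning
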